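{- Let $N_1,N_2$ be unary predicate symbols, $S_1,S_2$ unary function symbols and $0_1,0_2$ constant symbols. Let $T_1$ be the first-order Peano axioms for $(N_1,0_1,S_1)$ (that is, $N_1(0_1)$, $\forall x(N_1(x)\to N_1(S_1(x)))$, $\forall x(N_1(x)\to S_1(x)\neq 0_1)$, injectivity of $S_1$ on $N_1$), with the induction schema $$(\psi(0_1,\vec y)\wedge\forall x((N_1(x)\wedge\psi(x,\vec y))\to\psi(S_1(x),\vec y)))\to\forall x(N_1(x)\to\psi(x,\vec y))$$ for every first-order formula $\psi(x,\vec y)$ in the joint vocabulary $\{N_1,0_1,S_1\}\cup\{N_2,0_2,S_2\}$ (whose quantifiers range over the whole domain). Let $T_2$ be the corresponding theory for $(N_2,0_2,S_2)$ (with induction for formulas of the same joint vocabulary). Then $T_1\cup T_2$ does not suffice to establish an isomorphism between $(N_1,0_1,S_1)$ and $(N_2,0_2,S_2)$: there is a model $M'$ of $T_1\cup T_2$ such that $(N_1^{M'},0_1^{M'},S_1^{M'})$ and $(N_2^{M'},0_2^{M'},S_2^{M'})$ are not isomorphic. -}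

module Defs where

open import Data.Nat using (ℕ; zero; suc)
open import Data.Product using (_×_)
open import Data.Empty using (⊥)
open import Relation.Nullary using (¬_)
open import Relation.Binary.PropositionalEquality using (_≡_)

-- First-order logic with equality over the joint vocabulary
-- {N₁, 0₁, S₁} ∪ {N₂, 0₂, S₂}.  Variables are de Bruijn indices (ℕ).

data Term : Set where
  var  : ℕ → Term
  zer₁ : Term
  zer₂ : Term
  suc₁ : Term → Term
  suc₂ : Term → Term

data Formula : Set where
  N₁   : Term → Formula
  N₂   : Term → Formula
  _≐_  : Term → Term → Formula
  ⊥'   : Formula
  _⇒_  : Formula → Formula → Formula
  _∧'_ : Formula → Formula → Formula
  _∨'_ : Formula → Formula → Formula
  ¬'_  : Formula → Formula
  ∀'   : Formula → Formula
  ∃'   : Formula → Formula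

record Structure : Set₁ where
  field
    D   : Set
    n₁  : D → Set
    n₂  : D → Set
    z₁  : D
    z₂  : D
    s₁  : D → D
    s₂  : D → D

_∷ₑ_ : {D : Set} → D → (ℕ → D) → (ℕ → D)
(a ∷ₑ ρ) zero    = a
(a ∷ₑ ρ) (suc i) = ρ i

¬¬_ : Set → Set
¬¬ P = ¬ ¬ P

module _ (M : Structure) where
  open Structure M

  evalT : (ℕ → D) → Term → D
  evalT ρ (var i)  = ρ i
  evalT ρ zer₁     = z₁
  evalT ρ zer₂     = z₂
  evalT ρ (suc₁ t) = s₁ (evalT ρ t)
  evalT ρ (suc₂ t) = s₂ (evalT ρ t)

  -- Classical (Tarskian) satisfaction, rendered via the Gödel–Gentzen
  -- negative translation so that it agrees with classical semantics.
  Sat : (ℕ → D) → Formula → Set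
  Sat ρ (N₁ t)    = ¬¬ n₁ (evalT ρ t)
  Sat ρ (N₂ t)    = ¬¬ n₂ (evalT ρ t)
  Sat ρ (t ≐ u)   = ¬¬ (evalT ρ t ≡ evalT ρ u)
  Sat ρ ⊥'        = ⊥
  Sat ρ (φ ⇒ ψ)   = Sat ρ φ → Sat ρ ψ
  Sat ρ (φ ∧' ψ)  = Sat ρ φ × Sat ρ ψ
  Sat ρ (φ ∨' ψ)  = ¬ (¬ Sat ρ φ × ¬ Sat ρ ψ)
  Sat ρ (¬' φ)    = ¬ Sat ρ φ
  Sat ρ (∀' φ)    = (a : D) → Sat (a ∷ₑ ρ) φ
  Sat ρ (∃' φ)    = ¬ ((a : D) → ¬ Sat (a ∷ₑ ρ) φ)

-- M ⊨ T_i: first-order Peano axioms for (N_i, 0_i, S_i) with the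
-- induction schema for ALL formulas ψ(x, y⃗) of the joint vocabulary
-- (x = variable 0, parameters y⃗ = the remaining variables, given by ρ).
record PeanoModel (M : Structure) (N : Structure.D M → Set)
                  (z : Structure.D M) (s : Structure.D M → Structure.D M) : Set where
  open Structure M
  field
    zero-N  : ¬¬ N z
    suc-N   : (x : D) → ¬¬ N x → ¬¬ N (s x)
    suc≢0   : (x : D) → ¬¬ N x → ¬ (s x ≡ z)
    suc-inj : (x y : D) → ¬¬ N x → ¬¬ N y → ¬¬ (s x ≡ s y) → ¬¬ (x ≡ y)
    induction : (ψ : Formula) (ρ : ℕ → D) →
                Sat M (z ∷ₑ ρ) ψ →
                ((x : D) → ¬¬ N x → Sat M (x ∷ₑ ρ) ψ → Sat M (s x ∷ₑ ρ) ψ) →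
                (x : D) → ¬¬ N x → Sat M (x ∷ₑ ρ) ψ

ModelOfT₁∪T₂ : Structure → Set
ModelOfT₁∪T₂ M = PeanoModel M n₁ z₁ s₁ × PeanoModel M n₂ z₂ s₂
  where open Structure M

-- An isomorphism (N₁^M, 0₁^M, S₁^M) ≅ (N₂^M, 0₂^M, S₂^M): maps f, g
-- (values outside N₁ resp. N₂ irrelevant) between the extensions,
-- mutually inverse on them, sending 0₁ to 0₂ and commuting with successor.
record Iso (M : Structure) : Set where
  open Structure M
  field
    f        : D → D
    g        : D → D
    f-into   : (x : D) → ¬¬ n₁ x → ¬¬ n₂ (f x)
    g-into   : (y : D) → ¬¬ n₂ y → ¬¬ n₁ (g y)
    gf       : (x : D) → ¬¬ n₁ x → ¬¬ (g (f x) ≡ x)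
    fg       : (y : D) → ¬¬ n₂ y → ¬¬ (f (g y) ≡ y)
    f-zero   : ¬¬ (f z₁ ≡ z₂)
    f-suc    : (x : D) → ¬¬ n₁ x → ¬¬ (f (s₁ x) ≡ s₂ (f x))

{-# OPTIONS --safe #-}
module Submission where

-- The model consists of three copies of ℤ, the first line, the second line and the chain, with
-- successor x ↦ x + 1 on each. N₁ is the non-negative part of the first line; N₂ is the
-- non-negative part of the second line followed by the whole chain, so it has order type ℕ + ℤ
-- and cannot be isomorphic to the standard N₁.
--
-- For N₂, a formula ψ that holds on the standard part must
-- hold at some chain point lying below every parameter, and then by the induction step at every
-- chain point above it. This is an Ehrenfeucht–Fraïssé argument on the offsets between points:
-- tuples whose pairwise offsets agree up to threshold 2K+1 can be extended by one point each so
-- that they agree up to threshold K, so tuples agreeing up to a threshold that is large for the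
-- quantifier depth of a formula satisfy it simultaneously. A point of the second line far above
-- all parameters and a chain point far below them have the same offsets from the parameters and
-- origins up to any threshold, so ψ cannot tell them apart.

open import Defs
open import Data.Bool.Base using (Bool; true; false)
open import Data.Empty using (⊥; ⊥-elim)
open import Data.Integer.Base as ℤ
  using (ℤ; +_; -[1+_]; _+_; _-_; -_; 0ℤ; 1ℤ; ∣_∣; _≤_; _<_; +≤+; -≤+; -≤-)
import Data.Integer.Properties as ℤ
open import Data.Integer.Tactic.RingSolver using (solve-∀)
open import Data.Nat.Base as ℕ using (ℕ; zero; suc; z≤n; s≤s; _⊔_)
import Data.Nat.Properties as ℕ
open import Data.Product using (Σ; ∃; _×_; _,_; proj₁; proj₂)
open import Data.Sum using (_⊎_; inj₁; inj₂)
open import Function using (_∘_)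
open import Relation.Binary.Definitions using (tri<; tri≈; tri>)
open import Relation.Binary.PropositionalEquality
open import Relation.Nullary using (¬_; Dec; yes; no)
open import Relation.Nullary.Decidable using (map′; _×-dec_; _⊎-dec_; decidable-stable)
open import Relation.Nullary.Negation using (¬¬-map)

i≤j⇒j≡i+n : ∀ {i j} → i ≤ j → ∃ λ n → j ≡ i + + n
i≤j⇒j≡i+n {i} {j} i≤j = go (j - i) refl (ℤ.i≤j⇒0≤j-i i≤j)
  where
  j≡i+[j-i] : ∀ i j → j ≡ i + (j - i)
  j≡i+[j-i] = solve-∀
  go : ∀ k → j - i ≡ k → 0ℤ ≤ k → ∃ λ n → j ≡ i + + n
  go (+ n) eq _ = n , trans (j≡i+[j-i] i j) (cong (λ k → i + k) eq)

i+n≡j⇒i≤j : ∀ {i j} n → i + + n ≡ j → i ≤ j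
i+n≡j⇒i≤j {i} n refl = ℤ.i≤i+j i (+ n)

∣i∣≤n⇒i≤n : ∀ {i n} → ∣ i ∣ ℕ.≤ n → i ≤ + n
∣i∣≤n⇒i≤n {+ _}       i≤n = +≤+ i≤n
∣i∣≤n⇒i≤n { -[1+ _ ]} _   = -≤+

∣i∣≤n⇒-n≤i : ∀ {i n} → ∣ i ∣ ℕ.≤ n → - + n ≤ i
∣i∣≤n⇒-n≤i {+ _}       _         = ℤ.neg-≤-pos
∣i∣≤n⇒-n≤i { -[1+ _ ]} (s≤s i≤n) = -≤- i≤n

∣m-n∣≤K : ∀ {m n K} → m ℕ.≤ K → n ℕ.≤ K → ∣ + m - + n ∣ ℕ.≤ K
∣m-n∣≤K {m} {n} m≤K n≤K =
  subst (ℕ._≤ _) (cong ∣_∣ (sym (ℤ.m-n≡m⊖n m n))) (ℕ.≤-trans (ℤ.∣m⊝n∣≤m⊔n m n) (ℕ.⊔-lub m≤K n≤K))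

ℤ-induction-from : ∀ (A : ℤ → Set) {w} → A w → (∀ {v} → w ≤ v → A v → A (1ℤ + v)) →
                   ∀ {v} → w ≤ v → A v
ℤ-induction-from A {w} Aw step w≤v with i≤j⇒j≡i+n w≤v
... | n , refl = go n
  where
  1+[w+n]≡w+[1+n] : ∀ w n → 1ℤ + (w + n) ≡ w + (1ℤ + n)
  1+[w+n]≡w+[1+n] = solve-∀
  go : ∀ n → A (w + + n)
  go zero    = subst A (sym (ℤ.+-identityʳ w)) Aw
  go (suc n) = subst A (1+[w+n]≡w+[1+n] w (+ n)) (step (ℤ.i≤i+j w (+ n)) (go n))

search : ∀ {P : ℕ → Set} → (∀ i → Dec (P i)) → ∀ N →
         (∀ {i} → i ℕ.< N → ¬ P i) ⊎ ∃ λ j → j ℕ.< N × P j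
search P? N with ℕ.anyUpTo? P? N
... | yes found = inj₂ found
... | no  none  = inj₁ λ i<N Pi → none (_ , i<N , Pi)

below-or-at : ∀ (Q : ℕ → Set) {N} → (∀ {i} → i ℕ.< N → Q i) → Q N → ∀ {i} → i ℕ.< suc N → Q i
below-or-at Q below at i<1+N with ℕ.m<1+n⇒m<n∨m≡n i<1+N
... | inj₁ i<N  = below i<N
... | inj₂ refl = at

module _ {P : ℕ → Set} (P? : ∀ i → Dec (P i)) (f : ℕ → ℤ) where

  Maximum : ℕ → Set
  Maximum N = ∃ λ j → j ℕ.< N × P j × (∀ {i} → i ℕ.< N → P i → f i ≤ f j)

  private
    candidate : ∀ {N} j → j ℕ.< suc N → P j →
                (∀ {i} → i ℕ.< N → P i → f i ≤ f j) → (P N → f N ≤ f j) → Maximum (suc N)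
    candidate j j<1+N Pj below at = j , j<1+N , Pj , below-or-at (λ i → P i → f i ≤ f j) below at

  maximise : ∀ N → (∀ {i} → i ℕ.< N → ¬ P i) ⊎ Maximum N
  maximise zero = inj₁ λ ()
  maximise (suc N) with maximise N | P? N
  ... | inj₁ none | no  ¬PN = inj₁ (below-or-at (¬_ ∘ P) none ¬PN)
  ... | inj₁ none | yes PN  =
    inj₂ (candidate N ℕ.≤-refl PN (λ i<N → ⊥-elim ∘ none i<N) (λ _ → ℤ.≤-refl))
  ... | inj₂ (j , j<N , Pj , max) | no ¬PN =
    inj₂ (candidate j (ℕ.m<n⇒m<1+n j<N) Pj max (⊥-elim ∘ ¬PN))
  ... | inj₂ (j , j<N , Pj , max) | yes PN with f N ℤ.≤? f j
  ...   | yes fN≤fj = inj₂ (candidate j (ℕ.m<n⇒m<1+n j<N) Pj max (λ _ → fN≤fj))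
  ...   | no  fN≰fj =
    inj₂ (candidate N ℕ.≤-refl PN (λ i<N Pi → ℤ.≤-trans (max i<N Pi) fj≤fN) (λ _ → ℤ.≤-refl))
    where
    fj≤fN : f j ≤ f N
    fj≤fN = ℤ.<⇒≤ (ℤ.≰⇒> fN≰fj)

data Offset : Set where
  fin       : ℤ → Offset
  +∞ -∞     : Offset
  unrelated : Offset

negate : Offset → Offset
negate (fin x)   = fin (- x)
negate +∞        = -∞
negate -∞        = +∞
negate unrelated = unrelated

infixl 6 _⊕_
_⊕_ : Offset → ℤ → Offset
fin x     ⊕ d = fin (x + d)
+∞        ⊕ _ = +∞
-∞        ⊕ _ = -∞
unrelated ⊕ _ = unrelated

data Near (K : ℕ) : Offset → Set where
  finite : ∀ {x} → ∣ x ∣ ℕ.≤ K → Near K (fin x)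

data Above (K : ℕ) : Offset → Set where
  finite   : ∀ {x} → + suc K ≤ x → Above K (fin x)
  infinite : Above K +∞

data Below (K : ℕ) : Offset → Set where
  finite   : ∀ {x} → x ≤ -[1+ K ] → Below K (fin x)
  infinite : Below K -∞

near? : ∀ K E → Dec (Near K E)
near? K (fin x)   = map′ finite (λ { (finite ∣x∣≤K) → ∣x∣≤K }) (∣ x ∣ ℕ.≤? K)
near? K +∞        = no λ ()
near? K -∞        = no λ ()
near? K unrelated = no λ ()

below? : ∀ K E → Dec (Below K E)
below? K (fin x)   = map′ finite (λ { (finite x<-K) → x<-K }) (x ℤ.≤? -[1+ K ])
below? K +∞        = no λ ()
below? K -∞        = yes infinite
below? K unrelated = no λ ()

Near⇒fin : ∀ {K E} → Near K E → ∃ λ d → E ≡ fin d × ∣ d ∣ ℕ.≤ K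
Near⇒fin (finite ∣d∣≤K) = _ , refl , ∣d∣≤K

Above-fin : ∀ {K x} → Above K (fin x) → + suc K ≤ x
Above-fin (finite K<x) = K<x

Above⇒¬Below : ∀ {K L E} → Above K E → ¬ Below L E
Above⇒¬Below (finite K<x) (finite x<-L) with ℤ.≤-trans K<x x<-L
... | ()

Near⇒¬Above : ∀ {K E} → Near K E → ¬ Above K E
Near⇒¬Above (finite ∣x∣≤K) (finite K<x) = ℕ.1+n≰n (ℤ.drop‿+≤+ (ℤ.≤-trans K<x (∣i∣≤n⇒i≤n ∣x∣≤K)))

Near⇒¬Below : ∀ {K E} → Near K E → ¬ Below K E
Near⇒¬Below (finite {x} ∣x∣≤K) (finite x<-K) =
  Near⇒¬Above (finite (subst (ℕ._≤ _) (sym (ℤ.∣-i∣≡∣i∣ x)) ∣x∣≤K)) (finite (ℤ.neg-mono-≤ x<-K))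

nonneg⇒¬Below : ∀ {K x} → 0ℤ ≤ x → ¬ Below K (fin x)
nonneg⇒¬Below 0≤x (finite x<-K) with ℤ.≤-trans 0≤x x<-K
... | ()

Near-negate : ∀ {K E} → Near K (negate E) → Near K E
Near-negate {E = fin x} (finite ∣-x∣≤K) = finite (subst (ℕ._≤ _) (ℤ.∣-i∣≡∣i∣ x) ∣-x∣≤K)

Above-negate : ∀ {K E} → Above K E → Below K (negate E)
Above-negate (finite K<x) = finite (ℤ.neg-mono-≤ K<x)
Above-negate infinite     = infinite

Below-negate : ∀ {K E} → Below K E → Above K (negate E)
Below-negate (finite x<-K) = finite (ℤ.neg-mono-≤ x<-K)
Below-negate infinite      = infinite

Above-mono : ∀ {K L E} → K ℕ.≤ L → Above L E → Above K E
Above-mono K≤L (finite L<x) = finite (ℤ.≤-trans (+≤+ (s≤s K≤L)) L<x)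
Above-mono K≤L infinite     = infinite

Below-mono : ∀ {K L E} → K ℕ.≤ L → Below L E → Below K E
Below-mono K≤L (finite x<-L) = finite (ℤ.≤-trans x<-L (-≤- K≤L))
Below-mono K≤L infinite      = infinite

nonneg-far⇒Above : ∀ {K x} → 0ℤ ≤ x → ¬ Near K (fin x) → Above K (fin x)
nonneg-far⇒Above {K} {+ n} _ ¬near with n ℕ.≤? K
... | yes n≤K = ⊥-elim (¬near (finite n≤K))
... | no  n≰K = finite (+≤+ (ℕ.≰⇒> n≰K))

nonpos-far⇒Below : ∀ {K x} → x ≤ 0ℤ → ¬ Near K (fin x) → Below K (fin x)
nonpos-far⇒Below {K} {x} x≤0 ¬near
  with nonneg-far⇒Above {K} { - x} (ℤ.neg-mono-≤ x≤0) (¬near ∘ Near-negate)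
... | finite K<-x = finite (subst (_≤ _) (ℤ.neg-involutive x) (ℤ.neg-mono-≤ K<-x))

infix 4 _≈[_]_
data _≈[_]_ (E : Offset) (K : ℕ) : Offset → Set where
  above : ∀ {E'} → Above K E → Above K E' → E ≈[ K ] E'
  below : ∀ {E'} → Below K E → Below K E' → E ≈[ K ] E'
  same  : E ≈[ K ] E

≈-sym : ∀ {K E E'} → E ≈[ K ] E' → E' ≈[ K ] E
≈-sym (above a a') = above a' a
≈-sym (below b b') = below b' b
≈-sym same         = same

≈-negate : ∀ {K E E'} → E ≈[ K ] E' → negate E ≈[ K ] negate E'
≈-negate (above a a') = below (Above-negate a) (Above-negate a')
≈-negate (below b b') = above (Below-negate b) (Below-negate b')
≈-negate same         = same

≈-coarsen : ∀ {K L E E'} → K ℕ.≤ L → E ≈[ L ] E' → E ≈[ K ] E'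
≈-coarsen K≤L (above a a') = above (Above-mono K≤L a) (Above-mono K≤L a')
≈-coarsen K≤L (below b b') = below (Below-mono K≤L b) (Below-mono K≤L b')
≈-coarsen K≤L same         = same

≈-Below : ∀ {K E E'} → E ≈[ K ] E' → Below K E → Below K E'
≈-Below (above a _)  b = ⊥-elim (Above⇒¬Below a b)
≈-Below (below _ b') _ = b'
≈-Below same         b = b

≈-Near : ∀ {K E E'} → E ≈[ K ] E' → Near K E → E' ≡ E
≈-Near (above a _) n = ⊥-elim (Near⇒¬Above n a)
≈-Near (below b _) n = ⊥-elim (Near⇒¬Below n b)
≈-Near same        _ = refl

≈-⊕-small : ∀ {K d E E'} → ∣ d ∣ ℕ.≤ K → E ≈[ suc (K ℕ.+ K) ] E' → E ⊕ d ≈[ K ] E' ⊕ d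
≈-⊕-small {K} {d} ∣d∣≤K (above a a') = above (shift a) (shift a')
  where
  [1+K]+1≡[2+2K]-K : ∀ k → (1ℤ + k) + 1ℤ ≡ (1ℤ + (1ℤ + (k + k))) - k
  [1+K]+1≡[2+2K]-K = solve-∀
  shift : ∀ {E} → Above (suc (K ℕ.+ K)) E → Above K (E ⊕ d)
  shift (finite L<x) = finite (ℤ.≤-trans (i+n≡j⇒i≤j 1 ([1+K]+1≡[2+2K]-K (+ K)))
                                         (ℤ.+-mono-≤ L<x (∣i∣≤n⇒-n≤i ∣d∣≤K)))
  shift infinite     = infinite
≈-⊕-small {K} {d} ∣d∣≤K (below b b') = below (shift b) (shift b')
  where
  [-2-2K+K]+1≡-1-K : ∀ k → (- (1ℤ + (1ℤ + (k + k))) + k) + 1ℤ ≡ - (1ℤ + k)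
  [-2-2K+K]+1≡-1-K = solve-∀
  shift : ∀ {E} → Below (suc (K ℕ.+ K)) E → Below K (E ⊕ d)
  shift (finite x<-L) = finite (ℤ.≤-trans (ℤ.+-mono-≤ x<-L (∣i∣≤n⇒i≤n ∣d∣≤K))
                                          (i+n≡j⇒i≤j 1 ([-2-2K+K]+1≡-1-K (+ K))))
  shift infinite      = infinite
≈-⊕-small _ same = same

-- In use E is the offset from a point p to the highest point q below the new point q + d: every
-- p above q then lies far above q + d, and on the other side q' + (K + 1) will do.
≈-⊕-large : ∀ {K d E E'} → + suc K ≤ d → (Below 0 E → Below K (E ⊕ d)) →
            E ≈[ suc (K ℕ.+ K) ] E' → E ⊕ d ≈[ K ] E' ⊕ + suc K
≈-⊕-large {K} {d} {E} K<d far E≈E' with below? 0 E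
... | yes E<0 = below (far E<0) (lower (≈-Below E≈E' (unshift (far E<0))))
  where
  x+d-d≡x : ∀ x d → x + d - d ≡ x
  x+d-d≡x = solve-∀
  -2-2K+[1+K]≡-1-K : ∀ k → - (1ℤ + (1ℤ + (k + k))) + (1ℤ + k) ≡ - (1ℤ + k)
  -2-2K+[1+K]≡-1-K = solve-∀
  unshift : ∀ {E} → Below K (E ⊕ d) → Below (suc (K ℕ.+ K)) E
  unshift {fin x} (finite x+d<-K) =
    finite (subst (_≤ _) (x+d-d≡x x d) (ℤ.+-mono-≤ x+d<-K (ℤ.neg-mono-≤ K<d)))
  unshift { -∞}   infinite        = infinite
  lower : ∀ {E} → Below (suc (K ℕ.+ K)) E → Below K (E ⊕ + suc K)
  lower (finite x<-L) =
    finite (ℤ.≤-trans (ℤ.+-mono-≤ x<-L ℤ.≤-refl) (ℤ.≤-reflexive (-2-2K+[1+K]≡-1-K (+ K))))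
  lower infinite      = infinite
... | no E≮0 = raise E≮0 E≈E'
  where
  nonneg-raise : ∀ {x e} → 0ℤ ≤ x → + suc K ≤ e → Above K (fin x ⊕ e)
  nonneg-raise 0≤x K<e = finite (ℤ.+-mono-≤ 0≤x K<e)
  raise-above : ∀ {E e} → + suc K ≤ e → Above (suc (K ℕ.+ K)) E → Above K (E ⊕ e)
  raise-above K<e (finite L<x) = nonneg-raise (ℤ.≤-trans (+≤+ z≤n) L<x) K<e
  raise-above K<e infinite     = infinite
  raise : ∀ {E E'} → ¬ Below 0 E → E ≈[ suc (K ℕ.+ K) ] E' → E ⊕ d ≈[ K ] E' ⊕ + suc K
  raise _   (above a a') = above (raise-above K<d a) (raise-above ℤ.≤-refl a')
  raise E≮0 (below b _)  = ⊥-elim (E≮0 (Below-mono z≤n b))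
  raise {fin (+ _)}    _   same = above (nonneg-raise (+≤+ z≤n) K<d) (nonneg-raise (+≤+ z≤n) ℤ.≤-refl)
  raise {fin -[1+ _ ]} E≮0 same = ⊥-elim (E≮0 (finite (-≤- z≤n)))
  raise {+∞}           _   same = above infinite infinite
  raise { -∞}          E≮0 same = ⊥-elim (E≮0 infinite)
  raise {unrelated}    _   same = same

data Line : Set where
  first second chain : Line

_≟ₗ_ : (l l' : Line) → Dec (l ≡ l')
first  ≟ₗ first  = yes refl
second ≟ₗ second = yes refl
chain  ≟ₗ chain  = yes refl
first  ≟ₗ second = no λ ()
first  ≟ₗ chain  = no λ ()
second ≟ₗ first  = no λ ()
second ≟ₗ chain  = no λ ()
chain  ≟ₗ first  = no λ ()
chain  ≟ₗ second = no λ ()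

Point : Set
Point = Line × ℤ

line : Point → Line
line = proj₁

pos : Point → ℤ
pos = proj₂

move : ℤ → Point → Point
move d (l , v) = l , d + v

-- The chain lies above the whole second line; the first line is unrelated to both.
cross : Line → Line → ℤ → Offset
cross first  first  x = fin x
cross second second x = fin x
cross chain  chain  x = fin x
cross second chain  _ = +∞
cross chain  second _ = -∞
cross first  second _ = unrelated
cross first  chain  _ = unrelated
cross second first  _ = unrelated
cross chain  first  _ = unrelated

offset : Point → Point → Offset
offset (l , u) (l' , v) = cross l l' (v - u)

reflect : Line → Line
reflect first  = first
reflect second = chain
reflect chain  = second

mirror : Point → Point
mirror (l , v) = reflect l , - v

cross-diagonal : ∀ l x → cross l l x ≡ fin x
cross-diagonal first  x = refl
cross-diagonal second x = refl
cross-diagonal chain  x = refl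

cross≡fin : ∀ l l' {x y} → cross l l' x ≡ fin y → l ≡ l' × x ≡ y
cross≡fin first  first  refl = refl , refl
cross≡fin second second refl = refl , refl
cross≡fin chain  chain  refl = refl , refl
cross≡fin second chain  ()
cross≡fin chain  second ()
cross≡fin first  second ()
cross≡fin first  chain  ()
cross≡fin second first  ()
cross≡fin chain  first  ()

cross-negate : ∀ l l' x → cross l' l (- x) ≡ negate (cross l l' x)
cross-negate first  first  x = refl
cross-negate second second x = refl
cross-negate chain  chain  x = refl
cross-negate second chain  x = refl
cross-negate chain  second x = refl
cross-negate first  second x = refl
cross-negate first  chain  x = refl
cross-negate second first  x = refl
cross-negate chain  first  x = refl

cross-reflect : ∀ l l' x → cross (reflect l) (reflect l') (- x) ≡ negate (cross l l' x)
cross-reflect first  first  x = refl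
cross-reflect second second x = refl
cross-reflect chain  chain  x = refl
cross-reflect second chain  x = refl
cross-reflect chain  second x = refl
cross-reflect first  second x = refl
cross-reflect first  chain  x = refl
cross-reflect second first  x = refl
cross-reflect chain  first  x = refl

cross-⊕ : ∀ l l' x d → cross l l' (x + d) ≡ cross l l' x ⊕ d
cross-⊕ first  first  x d = refl
cross-⊕ second second x d = refl
cross-⊕ chain  chain  x d = refl
cross-⊕ second chain  x d = refl
cross-⊕ chain  second x d = refl
cross-⊕ first  second x d = refl
cross-⊕ first  chain  x d = refl
cross-⊕ second first  x d = refl
cross-⊕ chain  first  x d = refl

cross-Below : ∀ {K} l l' {x d} → l ≢ l' → Below 0 (cross l l' x) → Below K (cross l l' x ⊕ d)
cross-Below first  first  l≢l' _ = ⊥-elim (l≢l' refl)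
cross-Below second second l≢l' _ = ⊥-elim (l≢l' refl)
cross-Below chain  chain  l≢l' _ = ⊥-elim (l≢l' refl)
cross-Below chain  second _ _    = infinite
cross-Below second chain  _ ()
cross-Below first  second _ ()
cross-Below first  chain  _ ()
cross-Below second first  _ ()
cross-Below chain  first  _ ()

offset-same-line : ∀ p q → line p ≡ line q → offset p q ≡ fin (pos q - pos p)
offset-same-line (l , u) (.l , v) refl = cross-diagonal l (v - u)

offset-self : ∀ p → offset p p ≡ fin 0ℤ
offset-self p = trans (offset-same-line p p refl) (cong fin (ℤ.+-inverseʳ (pos p)))

offset≡fin⇒move : ∀ p q {d} → offset p q ≡ fin d → q ≡ move d p
offset≡fin⇒move (l , u) (l' , v) eq with cross≡fin l l' eq
... | refl , refl = cong (l ,_) (v≡[v-u]+u v u)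
  where
  v≡[v-u]+u : ∀ v u → v ≡ (v - u) + u
  v≡[v-u]+u = solve-∀

offset-flip : ∀ p q → offset q p ≡ negate (offset p q)
offset-flip (l , u) (l' , v) = trans (cong (cross l' l) (u-v≡-[v-u] u v)) (cross-negate l l' (v - u))
  where
  u-v≡-[v-u] : ∀ u v → u - v ≡ - (v - u)
  u-v≡-[v-u] = solve-∀

offset-move : ∀ p q d → offset p (move d q) ≡ offset p q ⊕ d
offset-move (l , u) (l' , v) d =
  trans (cong (cross l l') ([d+v]-u≡[v-u]+d d v u)) (cross-⊕ l l' (v - u) d)
  where
  [d+v]-u≡[v-u]+d : ∀ d v u → (d + v) - u ≡ (v - u) + d
  [d+v]-u≡[v-u]+d = solve-∀

offset-mirror : ∀ p q → offset (mirror p) (mirror q) ≡ negate (offset p q)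
offset-mirror (l , u) (l' , v) =
  trans (cong (cross (reflect l) (reflect l')) (-v+u≡-[v-u] v u)) (cross-reflect l l' (v - u))
  where
  -v+u≡-[v-u] : ∀ v u → - v - - u ≡ - (v - u)
  -v+u≡-[v-u] = solve-∀

move-zero : ∀ p → move 0ℤ p ≡ p
move-zero (l , v) = cong (l ,_) (ℤ.+-identityˡ v)

move-move : ∀ d e p → move d (move e p) ≡ move (d + e) p
move-move d e (l , v) = cong (l ,_) (sym (ℤ.+-assoc d e v))

move≡move⇒offset : ∀ {k l} p q → move k p ≡ move l q → offset p q ≡ fin (k - l)
move≡move⇒offset {k} {l} (lp , u) (lq , w) eq with cong line eq
... | refl = trans (cross-diagonal lp (w - u)) (cong fin w-u≡k-l)
  where
  open ≡-Reasoning
  w-u≡[[l+w]-l]-u : ∀ w u l → w - u ≡ ((l + w) - l) - u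
  w-u≡[[l+w]-l]-u = solve-∀
  [[k+u]-l]-u≡k-l : ∀ k u l → ((k + u) - l) - u ≡ k - l
  [[k+u]-l]-u≡k-l = solve-∀
  w-u≡k-l : w - u ≡ k - l
  w-u≡k-l = begin
    w - u             ≡⟨ w-u≡[[l+w]-l]-u w u l ⟩
    ((l + w) - l) - u ≡⟨ cong (λ z → (z - l) - u) (sym (cong pos eq)) ⟩
    ((k + u) - l) - u ≡⟨ [[k+u]-l]-u≡k-l k u l ⟩
    k - l             ∎

move≡move-≈ : ∀ {K k l} p q p' q' → k ℕ.≤ K → l ℕ.≤ K → offset p q ≈[ K ] offset p' q' →
              move (+ k) p ≡ move (+ l) q → move (+ k) p' ≡ move (+ l) q'
move≡move-≈ {K} {k} {l} p q p' q' k≤K l≤K pq≈p'q' eq = begin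
  move (+ k) p'                    ≡⟨ cong (λ z → move z p') (sym (l+[k-l]≡k (+ l) (+ k))) ⟩
  move (+ l + (+ k - + l)) p'      ≡⟨ sym (move-move (+ l) (+ k - + l) p') ⟩
  move (+ l) (move (+ k - + l) p') ≡⟨ cong (move (+ l)) (sym (offset≡fin⇒move p' q' p'→q')) ⟩
  move (+ l) q'                    ∎
  where
  open ≡-Reasoning
  l+[k-l]≡k : ∀ l k → l + (k - l) ≡ k
  l+[k-l]≡k = solve-∀
  p→q : offset p q ≡ fin (+ k - + l)
  p→q = move≡move⇒offset {+ k} {+ l} p q eq
  p'→q' : offset p' q' ≡ fin (+ k - + l)
  p'→q' = trans (≈-Near pq≈p'q' (subst (Near K) (sym p→q) (finite (∣m-n∣≤K k≤K l≤K)))) p→q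

reflect-involutive : ∀ l → reflect (reflect l) ≡ l
reflect-involutive first  = refl
reflect-involutive second = refl
reflect-involutive chain  = refl

mirror-involutive : ∀ p → mirror (mirror p) ≡ p
mirror-involutive (l , v) = cong₂ _,_ (reflect-involutive l) (ℤ.neg-involutive v)

infix 4 _<ₗ_
_<ₗ_ : Point → Point → Set
p <ₗ q = line p ≡ line q × pos p < pos q

_<ₗ?_ : ∀ p q → Dec (p <ₗ q)
p <ₗ? q = (line p ≟ₗ line q) ×-dec (pos p ℤ.<? pos q)

same-line-Below : ∀ {K} p q → line p ≡ line q → pos q ≤ pos p → ¬ Near K (offset p q) →
                  Below K (offset p q)
same-line-Below p q p∼q q≤p ¬near =
  subst (Below _) (sym p→q) (nonpos-far⇒Below (ℤ.i≤j⇒i-j≤0 q≤p) (¬near ∘ subst (Near _) (sym p→q)))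
  where
  p→q : offset p q ≡ fin (pos q - pos p)
  p→q = offset-same-line p q p∼q

other-line : ∀ {K} p a → ¬ Near K (offset p a) → ¬ p <ₗ a → ¬ mirror p <ₗ mirror a → line p ≢ line a
other-line p a ¬near ¬p<a ¬a<p p∼a with ℤ.<-cmp (pos p) (pos a)
... | tri< p<a _ _ = ¬p<a (p∼a , p<a)
... | tri> _ _ a<p = ¬a<p (cong reflect p∼a , ℤ.neg-mono-< a<p)
... | tri≈ _ p≡a _ =
  ¬near (subst (Near _) (sym (trans (offset-same-line p a p∼a) (cong fin a-p≡0))) (finite z≤n))
  where
  a-p≡0 : pos a - pos p ≡ 0ℤ
  a-p≡0 = trans (cong (λ v → v - pos p) (sym p≡a)) (ℤ.+-inverseʳ (pos p))

radius : (ℕ → Point) → ℕ → ℕ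
radius P zero    = 0
radius P (suc N) = ∣ pos (P N) ∣ ⊔ radius P N

radius-bound : ∀ P {N i} → i ℕ.< N → ∣ pos (P i) ∣ ℕ.≤ radius P N
radius-bound P {suc N} = below-or-at (λ i → ∣ pos (P i) ∣ ℕ.≤ radius P (suc N))
  (ℕ.m≤n⇒m≤o⊔n ∣ pos (P N) ∣ ∘ radius-bound P) (ℕ.m≤m⊔n ∣ pos (P N) ∣ (radius P N))

far-above : ∀ {K b} u → ∣ u ∣ ℕ.≤ b → + suc K ≤ (+ b + + suc K) - u
far-above {K} {b} u ∣u∣≤b =
  ℤ.≤-trans (ℤ.≤-reflexive (sym (b+k-b≡k (+ b) (+ suc K))))
            (ℤ.+-monoʳ-≤ (+ b + + suc K) (ℤ.neg-mono-≤ (∣i∣≤n⇒i≤n {u} ∣u∣≤b)))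
  where
  b+k-b≡k : ∀ b k → (b + k) - b ≡ k
  b+k-b≡k = solve-∀

far-below : ∀ {K b} u → ∣ u ∣ ℕ.≤ b → - (+ b + + suc K) - u ≤ -[1+ K ]
far-below {K} {b} u ∣u∣≤b =
  ℤ.≤-trans (ℤ.+-monoʳ-≤ (- (+ b + + suc K)) (ℤ.neg-mono-≤ (∣i∣≤n⇒-n≤i {u} ∣u∣≤b)))
            (ℤ.≤-reflexive (-[b+k]+b≡-k (+ b) (+ suc K)))
  where
  -[b+k]+b≡-k : ∀ b k → - (b + k) - - b ≡ - k
  -[b+k]+b≡-k = solve-∀

isFirst : Line → Bool
isFirst first  = true
isFirst second = false
isFirst chain  = false

isFirst-reflect : ∀ l → isFirst (reflect l) ≡ isFirst l
isFirst-reflect first  = refl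
isFirst-reflect second = refl
isFirst-reflect chain  = refl

-- Lines are only compared as first or not, so that the second line and the chain may correspond.
record Similar (K N : ℕ) (P P' : ℕ → Point) : Set where
  field
    same-side : ∀ {i} → i ℕ.< N → isFirst (line (P i)) ≡ isFirst (line (P' i))
    offsets≈  : ∀ {i j} → i ℕ.< N → j ℕ.< N → offset (P i) (P j) ≈[ K ] offset (P' i) (P' j)
open Similar

Similar-refl : ∀ {K N P} → Similar K N P P
Similar-refl = record { same-side = λ _ → refl ; offsets≈ = λ _ _ → same }

Similar-sym : ∀ {K N P P'} → Similar K N P P' → Similar K N P' P
Similar-sym S = record
  { same-side = λ i<N → sym (same-side S i<N)
  ; offsets≈  = λ i<N j<N → ≈-sym (offsets≈ S i<N j<N)
  }

Similar-coarsen : ∀ {K L N P P'} → K ℕ.≤ L → Similar L N P P' → Similar K N P P'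
Similar-coarsen K≤L S = record
  { same-side = same-side S
  ; offsets≈  = λ i<N j<N → ≈-coarsen K≤L (offsets≈ S i<N j<N)
  }

Similar-cong : ∀ {K N P P' Q Q'} → (∀ i → P i ≡ Q i) → (∀ i → P' i ≡ Q' i) →
               Similar K N P P' → Similar K N Q Q'
Similar-cong {K} P≗Q P'≗Q' S = record
  { same-side = λ {i} i<N →
      subst₂ (λ q q' → isFirst (line q) ≡ isFirst (line q')) (P≗Q i) (P'≗Q' i) (same-side S i<N)
  ; offsets≈  = λ {i} {j} i<N j<N →
      subst₂ (_≈[ K ]_) (cong₂ offset (P≗Q i) (P≗Q j)) (cong₂ offset (P'≗Q' i) (P'≗Q' j))
        (offsets≈ S i<N j<N)
  }

Similar-mirror : ∀ {K N P P'} → Similar K N P P' → Similar K N (mirror ∘ P) (mirror ∘ P')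
Similar-mirror {K} {P = P} {P'} S = record
  { same-side = λ {i} i<N →
      trans (isFirst-reflect (line (P i)))
            (trans (same-side S i<N) (sym (isFirst-reflect (line (P' i)))))
  ; offsets≈  = λ {i} {j} i<N j<N →
      subst₂ (_≈[ K ]_) (sym (offset-mirror (P i) (P j))) (sym (offset-mirror (P' i) (P' j)))
        (≈-negate (offsets≈ S i<N j<N))
  }

Similar-∷ : ∀ {K L N P P' a a'} → K ℕ.≤ L → Similar L N P P' → isFirst (line a) ≡ isFirst (line a') →
            (∀ {i} → i ℕ.< N → offset (P i) a ≈[ K ] offset (P' i) a') →
            Similar K (suc N) (a ∷ₑ P) (a' ∷ₑ P')
Similar-∷ {K} {N = N} {P} {P'} {a} {a'} K≤L S a∼a' a≈a' =
  record { same-side = sides ; offsets≈ = offsets }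
  where
  sides : ∀ {i} → i ℕ.< suc N → isFirst (line ((a ∷ₑ P) i)) ≡ isFirst (line ((a' ∷ₑ P') i))
  sides {zero}  _         = a∼a'
  sides {suc i} (s≤s i<N) = same-side S i<N
  offsets : ∀ {i j} → i ℕ.< suc N → j ℕ.< suc N →
            offset ((a ∷ₑ P) i) ((a ∷ₑ P) j) ≈[ K ] offset ((a' ∷ₑ P') i) ((a' ∷ₑ P') j)
  offsets {zero}  {zero}  _         _         rewrite offset-self a | offset-self a' = same
  offsets {zero}  {suc j} _         (s≤s j<N) rewrite offset-flip (P j) a | offset-flip (P' j) a' =
    ≈-negate (a≈a' j<N)
  offsets {suc i} {zero}  (s≤s i<N) _         = a≈a' i<N
  offsets {suc i} {suc j} (s≤s i<N) (s≤s j<N) = ≈-coarsen K≤L (offsets≈ S i<N j<N)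

Similar-unmirror : ∀ {K N P P' a a'} →
                   Similar K (suc N) (mirror a ∷ₑ (mirror ∘ P)) (a' ∷ₑ (mirror ∘ P')) →
                   Similar K (suc N) (a ∷ₑ P) (mirror a' ∷ₑ P')
Similar-unmirror {P = P} {P'} {a} {a'} S = Similar-cong unmirror (mirror-∷ a' P') (Similar-mirror S)
  where
  mirror-∷ : ∀ b Q i → mirror ((b ∷ₑ (mirror ∘ Q)) i) ≡ (mirror b ∷ₑ Q) i
  mirror-∷ b Q zero    = refl
  mirror-∷ b Q (suc i) = mirror-involutive (Q i)
  unmirror : ∀ i → mirror ((mirror a ∷ₑ (mirror ∘ P)) i) ≡ (a ∷ₑ P) i
  unmirror i = trans (mirror-∷ (mirror a) P i) (cong (λ b → (b ∷ₑ P) i) (mirror-involutive a))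

K≤1+K+K : ∀ K → K ℕ.≤ suc (K ℕ.+ K)
K≤1+K+K K = ℕ.m≤n⇒m≤1+n (ℕ.m≤m+n K K)

extend-near : ∀ {K N P P' j a} → Similar (suc (K ℕ.+ K)) N P P' → j ℕ.< N → Near K (offset (P j) a) →
              Σ Point λ a' → Similar K (suc N) (a ∷ₑ P) (a' ∷ₑ P')
extend-near {K} {N} {P} {P'} {j} {a} S j<N near with Near⇒fin near
... | d , Pj→a , ∣d∣≤K =
  move d (P' j) , subst (λ b → Similar K (suc N) (b ∷ₑ P) _) (sym (offset≡fin⇒move (P j) a Pj→a)) S′
  where
  S′ : Similar K (suc N) (move d (P j) ∷ₑ P) (move d (P' j) ∷ₑ P')
  S′ = Similar-∷ (K≤1+K+K K) S (same-side S j<N) λ {i} i<N →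
         subst₂ (_≈[ K ]_) (sym (offset-move (P i) (P j) d)) (sym (offset-move (P' i) (P' j) d))
           (≈-⊕-small ∣d∣≤K (offsets≈ S i<N j<N))

extend-far : ∀ {K N P P' j d} → Similar (suc (K ℕ.+ K)) N P P' → j ℕ.< N → + suc K ≤ d →
             (∀ {i} → i ℕ.< N → Below 0 (offset (P i) (P j)) → Below K (offset (P i) (P j) ⊕ d)) →
             Similar K (suc N) (move d (P j) ∷ₑ P) (move (+ suc K) (P' j) ∷ₑ P')
extend-far {K} {P = P} {P'} {j} {d} S j<N K<d far =
  Similar-∷ (K≤1+K+K K) S (same-side S j<N) λ {i} i<N →
    subst₂ (_≈[ K ]_) (sym (offset-move (P i) (P j) d)) (sym (offset-move (P' i) (P' j) (+ suc K)))
      (≈-⊕-large K<d (far i<N) (offsets≈ S i<N j<N))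

extend-from-below : ∀ {K N P P'} → Similar (suc (K ℕ.+ K)) N P P' → ∀ a →
                    (∀ {i} → i ℕ.< N → ¬ Near K (offset (P i) a)) →
                    (∀ {i} → i ℕ.< N → ¬ P i <ₗ a) ⊎
                    Σ Point (λ a' → Similar K (suc N) (a ∷ₑ P) (a' ∷ₑ P'))
extend-from-below {K} {N} {P} {P'} S a ¬near with maximise (λ i → P i <ₗ? a) (pos ∘ P) N
... | inj₁ nothing-below = inj₁ nothing-below
... | inj₂ (j , j<N , (Pj∼a , Pj<a) , nearest) =
  inj₂ (_ , subst (λ b → Similar K (suc N) (b ∷ₑ P) _) (sym a≡) (extend-far S j<N K<d far))
  where
  d : ℤ
  d = pos a - pos (P j)
  Pj→a : offset (P j) a ≡ fin d
  Pj→a = offset-same-line (P j) a Pj∼a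
  a≡ : a ≡ move d (P j)
  a≡ = offset≡fin⇒move (P j) a Pj→a
  K<d : + suc K ≤ d
  K<d = Above-fin (nonneg-far⇒Above (ℤ.i≤j⇒0≤j-i (ℤ.<⇒≤ Pj<a))
                                    (¬near j<N ∘ subst (Near K) (sym Pj→a)))
  Pi→a : ∀ i → offset (P i) a ≡ offset (P i) (P j) ⊕ d
  Pi→a i = trans (cong (offset (P i)) a≡) (offset-move (P i) (P j) d)
  far : ∀ {i} → i ℕ.< N → Below 0 (offset (P i) (P j)) → Below K (offset (P i) (P j) ⊕ d)
  far {i} i<N Pj<Pi with line (P i) ≟ₗ line (P j)
  ... | no Pi≁Pj = cross-Below (line (P i)) (line (P j)) Pi≁Pj Pj<Pi
  ... | yes Pi∼Pj with P i <ₗ? a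
  ...   | yes Pi<a = ⊥-elim (nonneg⇒¬Below (ℤ.i≤j⇒0≤j-i (nearest i<N Pi<a))
                         (subst (Below 0) (offset-same-line (P i) (P j) Pi∼Pj) Pj<Pi))
  ...   | no  Pi≮a = subst (Below K) (Pi→a i)
                       (same-line-Below (P i) a Pi∼a (ℤ.≮⇒≥ (Pi≮a ∘ (Pi∼a ,_))) (¬near i<N))
    where
    Pi∼a : line (P i) ≡ line a
    Pi∼a = trans Pi∼Pj Pj∼a

extend-fresh : ∀ {K L N P P' a} → K ℕ.≤ L → Similar L N P P' →
               (∀ {i} → i ℕ.< N → line (P i) ≢ line a) →
               Σ Point λ a' → Similar K (suc N) (a ∷ₑ P) (a' ∷ₑ P')
extend-fresh {K} {N = N} {P} {P'} {l , v} K≤L S fresh =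
  a' l , Similar-∷ K≤L S (isFirst-a' l) λ {i} i<N →
    unrelated-or-far l (P i) (P' i) (fresh i<N) (same-side S i<N) (radius-bound P' i<N)
  where
  B : ℤ
  B = + radius P' N + + suc K
  a' : Line → Point
  a' first  = first , 0ℤ
  a' second = second , - B
  a' chain  = chain , B
  isFirst-a' : ∀ l → isFirst l ≡ isFirst (line (a' l))
  isFirst-a' first  = refl
  isFirst-a' second = refl
  isFirst-a' chain  = refl
  unrelated-or-far : ∀ l p p' → line p ≢ l → isFirst (line p) ≡ isFirst (line p') →
                     ∣ pos p' ∣ ℕ.≤ radius P' N → offset p (l , v) ≈[ K ] offset p' (a' l)
  unrelated-or-far first  (first  , _) _            p≁l _ _   = ⊥-elim (p≁l refl)
  unrelated-or-far first  (second , _) (second , _) _   _ _   = same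
  unrelated-or-far first  (second , _) (chain  , _) _   _ _   = same
  unrelated-or-far first  (chain  , _) (second , _) _   _ _   = same
  unrelated-or-far first  (chain  , _) (chain  , _) _   _ _   = same
  unrelated-or-far second (second , _) _            p≁l _ _   = ⊥-elim (p≁l refl)
  unrelated-or-far second (first  , _) (first  , _) _   _ _   = same
  unrelated-or-far second (chain  , _) (second , u) _   _ u≤b = below infinite (finite (far-below u u≤b))
  unrelated-or-far second (chain  , _) (chain  , _) _   _ _   = below infinite infinite
  unrelated-or-far chain  (chain  , _) _            p≁l _ _   = ⊥-elim (p≁l refl)
  unrelated-or-far chain  (first  , _) (first  , _) _   _ _   = same
  unrelated-or-far chain  (second , _) (second , _) _   _ _   = above infinite infinite
  unrelated-or-far chain  (second , _) (chain  , u) _   _ u≤b = above infinite (finite (far-above u u≤b))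
  unrelated-or-far _      (first  , _) (second , _) _   () _
  unrelated-or-far _      (first  , _) (chain  , _) _   () _
  unrelated-or-far _      (second , _) (first  , _) _   () _
  unrelated-or-far _      (chain  , _) (first  , _) _   () _

¬Near-mirror : ∀ {K} p a → ¬ Near K (offset p a) → ¬ Near K (offset (mirror p) (mirror a))
¬Near-mirror p a ¬near = ¬near ∘ Near-negate ∘ subst (Near _) (offset-mirror p a)

-- When no point of P lies below a on its line, reflecting the picture (which reverses all
-- offsets) turns a point above a into one below it.
extend : ∀ {K N P P'} → Similar (suc (K ℕ.+ K)) N P P' → ∀ a →
         Σ Point λ a' → Similar K (suc N) (a ∷ₑ P) (a' ∷ₑ P')
extend {K} {N} {P} {P'} S a with search (λ i → near? K (offset (P i) a)) N
... | inj₂ (j , j<N , near) = extend-near S j<N near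
... | inj₁ ¬near with extend-from-below S a ¬near
...   | inj₂ extended = extended
...   | inj₁ nothing-below
  with extend-from-below (Similar-mirror S) (mirror a) (λ {i} i<N → ¬Near-mirror (P i) a (¬near i<N))
...     | inj₂ (a' , S') = mirror a' , Similar-unmirror S'
...     | inj₁ nothing-above = extend-fresh (K≤1+K+K K) S λ {i} i<N →
  other-line (P i) a (¬near i<N) (nothing-below i<N) (nothing-above i<N)

origin₁ origin₂ : Point
origin₁ = first , 0ℤ
origin₂ = second , 0ℤ

successor : Point → Point
successor = move 1ℤ

IsN₁ : Point → Set
IsN₁ (l , v) = l ≡ first × 0ℤ ≤ v

IsN₂ : Point → Set
IsN₂ (l , v) = (l ≡ second × 0ℤ ≤ v) ⊎ l ≡ chain

𝕄 : Structure
𝕄 = record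
  { D  = Point
  ; n₁ = IsN₁ ; z₁ = origin₁ ; s₁ = successor
  ; n₂ = IsN₂ ; z₂ = origin₂ ; s₂ = successor
  }

data Reaches (k : ℕ) : Offset → Set where
  finite   : ∀ {x} → 0ℤ ≤ + k + x → Reaches k (fin x)
  infinite : Reaches k +∞

Below⇒¬Reaches : ∀ {K k E} → k ℕ.≤ K → Below K E → ¬ Reaches k E
Below⇒¬Reaches {K} k≤K (finite x<-K) (finite 0≤k+x) =
  0≰-1 (ℤ.≤-trans 0≤k+x (ℤ.≤-trans (ℤ.+-mono-≤ (+≤+ k≤K) x<-K) (ℤ.≤-reflexive (K-[1+K]≡-1 (+ K)))))
  where
  K-[1+K]≡-1 : ∀ k → k - (1ℤ + k) ≡ - 1ℤ
  K-[1+K]≡-1 = solve-∀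
  0≰-1 : ¬ 0ℤ ≤ - 1ℤ
  0≰-1 ()

Reaches-≈ : ∀ {K k E E'} → k ℕ.≤ K → E ≈[ K ] E' → Reaches k E → Reaches k E'
Reaches-≈ {k = k} _ (above _ (finite {x'} K<x')) _ =
  finite (ℤ.≤-trans (+≤+ z≤n) (ℤ.≤-trans K<x' (ℤ.i≤j+i x' (+ k))))
Reaches-≈ _   (above _ infinite) _ = infinite
Reaches-≈ k≤K (below b _)        r = ⊥-elim (Below⇒¬Reaches k≤K b r)
Reaches-≈ _   same               r = r

Reaches-fin : ∀ {k} u → 0ℤ ≤ + k + u → Reaches k (fin (u - 0ℤ))
Reaches-fin {k} u = finite ∘ subst (λ x → 0ℤ ≤ + k + x) (sym (ℤ.+-identityʳ u))

Reaches-fin⁻¹ : ∀ {k} u → Reaches k (fin (u - 0ℤ)) → 0ℤ ≤ + k + u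
Reaches-fin⁻¹ {k} u (finite 0≤k+u) = subst (λ x → 0ℤ ≤ + k + x) (ℤ.+-identityʳ u) 0≤k+u

IsN₁⇒Reaches : ∀ k p → IsN₁ (move (+ k) p) → Reaches k (offset origin₁ p)
IsN₁⇒Reaches k (first , u) (refl , 0≤k+u) = Reaches-fin u 0≤k+u

Reaches⇒IsN₁ : ∀ k p → Reaches k (offset origin₁ p) → IsN₁ (move (+ k) p)
Reaches⇒IsN₁ k (first  , u) r = refl , Reaches-fin⁻¹ u r
Reaches⇒IsN₁ k (second , u) ()
Reaches⇒IsN₁ k (chain  , u) ()

IsN₂⇒Reaches : ∀ k p → IsN₂ (move (+ k) p) → Reaches k (offset origin₂ p)
IsN₂⇒Reaches k (second , u) (inj₁ (refl , 0≤k+u)) = Reaches-fin u 0≤k+u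
IsN₂⇒Reaches k (chain  , u) _                     = infinite
IsN₂⇒Reaches k (first  , u) (inj₁ (() , _))
IsN₂⇒Reaches k (first  , u) (inj₂ ())
IsN₂⇒Reaches k (second , u) (inj₂ ())

Reaches⇒IsN₂ : ∀ k p → Reaches k (offset origin₂ p) → IsN₂ (move (+ k) p)
Reaches⇒IsN₂ k (second , u) r = inj₁ (refl , Reaches-fin⁻¹ u r)
Reaches⇒IsN₂ k (chain  , u) _ = inj₂ refl
Reaches⇒IsN₂ k (first  , u) ()

height : Term → ℕ
height (var _)  = 0
height zer₁     = 0
height zer₂     = 0
height (suc₁ t) = suc (height t)
height (suc₂ t) = suc (height t)

termScope : Term → ℕ
termScope (var i)  = suc i
termScope zer₁     = 0
termScope zer₂     = 0
termScope (suc₁ t) = termScope t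
termScope (suc₂ t) = termScope t

-- ρ 0, …, ρ (N - 1), 0₁, 0₂, followed by entries that no term below the bound N refers to.
withOrigins : ℕ → (ℕ → Point) → ℕ → Point
withOrigins zero    ρ = origin₁ ∷ₑ (origin₂ ∷ₑ ρ)
withOrigins (suc N) ρ = ρ 0 ∷ₑ withOrigins N (ρ ∘ suc)

anchor : ℕ → Term → ℕ
anchor N (var i)  = i
anchor N zer₁     = N
anchor N zer₂     = suc N
anchor N (suc₁ t) = anchor N t
anchor N (suc₂ t) = anchor N t

withOrigins-var : ∀ N ρ {i} → i ℕ.< N → withOrigins N ρ i ≡ ρ i
withOrigins-var (suc N) ρ {zero}  _         = refl
withOrigins-var (suc N) ρ {suc i} (s≤s i<N) = withOrigins-var N (ρ ∘ suc) i<N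

withOrigins-origin₁ : ∀ N ρ → withOrigins N ρ N ≡ origin₁
withOrigins-origin₁ zero    ρ = refl
withOrigins-origin₁ (suc N) ρ = withOrigins-origin₁ N (ρ ∘ suc)

withOrigins-origin₂ : ∀ N ρ → withOrigins N ρ (suc N) ≡ origin₂
withOrigins-origin₂ zero    ρ = refl
withOrigins-origin₂ (suc N) ρ = withOrigins-origin₂ N (ρ ∘ suc)

anchor< : ∀ {N} t → termScope t ℕ.≤ N → anchor N t ℕ.< suc (suc N)
anchor<     (var i)  i<N = ℕ.m<n⇒m<1+n (ℕ.m<n⇒m<1+n i<N)
anchor< {N} zer₁     _   = ℕ.m<n⇒m<1+n (ℕ.n<1+n N)
anchor< {N} zer₂     _   = ℕ.n<1+n (suc N)
anchor<     (suc₁ t) t<N = anchor< t t<N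
anchor<     (suc₂ t) t<N = anchor< t t<N

eval-anchor : ∀ {N} ρ t → termScope t ℕ.≤ N →
              evalT 𝕄 ρ t ≡ move (+ height t) (withOrigins N ρ (anchor N t))
eval-anchor {N} ρ (var i)  i<N = sym (trans (move-zero _) (withOrigins-var N ρ i<N))
eval-anchor {N} ρ zer₁     _   = sym (trans (move-zero _) (withOrigins-origin₁ N ρ))
eval-anchor {N} ρ zer₂     _   = sym (trans (move-zero _) (withOrigins-origin₂ N ρ))
eval-anchor {N} ρ (suc₁ t) t<N =
  trans (cong successor (eval-anchor ρ t t<N)) (move-move 1ℤ (+ height t) (withOrigins N ρ (anchor N t)))
eval-anchor {N} ρ (suc₂ t) t<N =
  trans (cong successor (eval-anchor ρ t t<N)) (move-move 1ℤ (+ height t) (withOrigins N ρ (anchor N t)))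

offsets-from≈ : ∀ {K N P P' o c i} → Similar K N P P' → o ℕ.< N → P o ≡ c → P' o ≡ c → i ℕ.< N →
                offset c (P i) ≈[ K ] offset c (P' i)
offsets-from≈ {K} {P = P} {P'} {i = i} S o<N Po≡c P'o≡c i<N =
  subst₂ (λ c c' → offset c (P i) ≈[ K ] offset c' (P' i)) Po≡c P'o≡c (offsets≈ S o<N i<N)

module _ {K N ρ ρ'} (S : Similar K (suc (suc N)) (withOrigins N ρ) (withOrigins N ρ')) where

  private
    base base' : Term → Point
    base  t = withOrigins N ρ (anchor N t)
    base' t = withOrigins N ρ' (anchor N t)

    from-origin₁ : ∀ t → termScope t ℕ.≤ N → offset origin₁ (base t) ≈[ K ] offset origin₁ (base' t)
    from-origin₁ t t<N = offsets-from≈ S (ℕ.m<n⇒m<1+n (ℕ.n<1+n N))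
      (withOrigins-origin₁ N ρ) (withOrigins-origin₁ N ρ') (anchor< t t<N)

    from-origin₂ : ∀ t → termScope t ℕ.≤ N → offset origin₂ (base t) ≈[ K ] offset origin₂ (base' t)
    from-origin₂ t t<N = offsets-from≈ S (ℕ.n<1+n (suc N))
      (withOrigins-origin₂ N ρ) (withOrigins-origin₂ N ρ') (anchor< t t<N)

  N₁-≈ : ∀ t → height t ℕ.≤ K → termScope t ℕ.≤ N → IsN₁ (evalT 𝕄 ρ t) → IsN₁ (evalT 𝕄 ρ' t)
  N₁-≈ t h≤K t<N =
      subst IsN₁ (sym (eval-anchor ρ' t t<N))
    ∘ Reaches⇒IsN₁ (height t) (base' t)
    ∘ Reaches-≈ h≤K (from-origin₁ t t<N)
    ∘ IsN₁⇒Reaches (height t) (base t)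
    ∘ subst IsN₁ (eval-anchor ρ t t<N)

  N₂-≈ : ∀ t → height t ℕ.≤ K → termScope t ℕ.≤ N → IsN₂ (evalT 𝕄 ρ t) → IsN₂ (evalT 𝕄 ρ' t)
  N₂-≈ t h≤K t<N =
      subst IsN₂ (sym (eval-anchor ρ' t t<N))
    ∘ Reaches⇒IsN₂ (height t) (base' t)
    ∘ Reaches-≈ h≤K (from-origin₂ t t<N)
    ∘ IsN₂⇒Reaches (height t) (base t)
    ∘ subst IsN₂ (eval-anchor ρ t t<N)

  ≐-≈ : ∀ t u → height t ℕ.≤ K → height u ℕ.≤ K → termScope t ℕ.≤ N → termScope u ℕ.≤ N →
        evalT 𝕄 ρ t ≡ evalT 𝕄 ρ u → evalT 𝕄 ρ' t ≡ evalT 𝕄 ρ' u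
  ≐-≈ t u ht≤K hu≤K t<N u<N ρ⊨t≐u = begin
    evalT 𝕄 ρ' t                  ≡⟨ eval-anchor ρ' t t<N ⟩
    move (+ height t) (base' t)    ≡⟨ move≡move-≈ (base t) (base u) (base' t) (base' u) ht≤K hu≤K
                                        (offsets≈ S (anchor< t t<N) (anchor< u u<N)) bases≡ ⟩
    move (+ height u) (base' u)    ≡⟨ sym (eval-anchor ρ' u u<N) ⟩
    evalT 𝕄 ρ' u                  ∎
    where
    open ≡-Reasoning
    bases≡ : move (+ height t) (base t) ≡ move (+ height u) (base u)
    bases≡ = trans (sym (eval-anchor ρ t t<N)) (trans ρ⊨t≐u (eval-anchor ρ u u<N))

-- Each quantifier costs one application of `extend`, which halves the threshold.
rank : Formula → ℕ
rank (N₁ t)   = height t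
rank (N₂ t)   = height t
rank (t ≐ u)  = height t ⊔ height u
rank ⊥'       = 0
rank (φ ⇒ ψ)  = rank φ ⊔ rank ψ
rank (φ ∧' ψ) = rank φ ⊔ rank ψ
rank (φ ∨' ψ) = rank φ ⊔ rank ψ
rank (¬' φ)   = rank φ
rank (∀' φ)   = suc (rank φ ℕ.+ rank φ)
rank (∃' φ)   = suc (rank φ ℕ.+ rank φ)

scope : Formula → ℕ
scope (N₁ t)   = termScope t
scope (N₂ t)   = termScope t
scope (t ≐ u)  = termScope t ⊔ termScope u
scope ⊥'       = 0
scope (φ ⇒ ψ)  = scope φ ⊔ scope ψ
scope (φ ∧' ψ) = scope φ ⊔ scope ψ
scope (φ ∨' ψ) = scope φ ⊔ scope ψ
scope (¬' φ)   = scope φ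
scope (∀' φ)   = ℕ.pred (scope φ)
scope (∃' φ)   = ℕ.pred (scope φ)

⊔-≤ˡ : ∀ {m n o} → m ⊔ n ℕ.≤ o → m ℕ.≤ o
⊔-≤ˡ {m} {n} = ℕ.m⊔n≤o⇒m≤o m n

⊔-≤ʳ : ∀ {m n o} → m ⊔ n ℕ.≤ o → n ℕ.≤ o
⊔-≤ʳ {m} {n} = ℕ.m⊔n≤o⇒n≤o m n

pred≤⇒≤suc : ∀ {m n} → ℕ.pred m ℕ.≤ n → m ℕ.≤ suc n
pred≤⇒≤suc {zero}  _   = z≤n
pred≤⇒≤suc {suc m} m≤n = s≤s m≤n

transfer : ∀ φ {K N ρ ρ'} → rank φ ℕ.≤ K → scope φ ℕ.≤ N →
           Similar K (suc (suc N)) (withOrigins N ρ) (withOrigins N ρ') → Sat 𝕄 ρ φ → Sat 𝕄 ρ' φ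
transfer (N₁ t)   r s S = ¬¬-map (N₁-≈ S t r s)
transfer (N₂ t)   r s S = ¬¬-map (N₂-≈ S t r s)
transfer (t ≐ u)  r s S = ¬¬-map (≐-≈ S t u (⊔-≤ˡ r) (⊔-≤ʳ r) (⊔-≤ˡ s) (⊔-≤ʳ s))
transfer ⊥'       r s S ()
transfer (φ ⇒ ψ)  r s S ρ⊨φ⇒ψ =
  transfer ψ (⊔-≤ʳ r) (⊔-≤ʳ s) S ∘ ρ⊨φ⇒ψ ∘ transfer φ (⊔-≤ˡ r) (⊔-≤ˡ s) (Similar-sym S)
transfer (φ ∧' ψ) r s S (ρ⊨φ , ρ⊨ψ) =
  transfer φ (⊔-≤ˡ r) (⊔-≤ˡ s) S ρ⊨φ , transfer ψ (⊔-≤ʳ r) (⊔-≤ʳ s) S ρ⊨ψ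
transfer (φ ∨' ψ) r s S ρ⊨φ∨ψ (ρ'⊭φ , ρ'⊭ψ) =
  ρ⊨φ∨ψ (ρ'⊭φ ∘ transfer φ (⊔-≤ˡ r) (⊔-≤ˡ s) S , ρ'⊭ψ ∘ transfer ψ (⊔-≤ʳ r) (⊔-≤ʳ s) S)
transfer (¬' φ)   r s S ρ⊭φ = ρ⊭φ ∘ transfer φ r s (Similar-sym S)
transfer (∀' φ)   r s S ρ⊨∀φ a' with extend (Similar-coarsen r (Similar-sym S)) a'
... | a , S' = transfer φ ℕ.≤-refl (pred≤⇒≤suc s) (Similar-sym S') (ρ⊨∀φ a)
transfer (∃' φ)   r s S ρ⊨∃φ ρ'⊭φ = ρ⊨∃φ λ a ρa⊨φ →
  let a' , S' = extend (Similar-coarsen r S) a in ρ'⊭φ a' (transfer φ ℕ.≤-refl (pred≤⇒≤suc s) S' ρa⊨φ)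

chain-from-second : ∀ ψ ρ → (∀ k → Sat 𝕄 ((second , + k) ∷ₑ ρ) ψ) →
                    (∀ {v} → Sat 𝕄 ((chain , v) ∷ₑ ρ) ψ → Sat 𝕄 ((chain , 1ℤ + v) ∷ₑ ρ) ψ) →
                    ∀ v → Sat 𝕄 ((chain , v) ∷ₑ ρ) ψ
chain-from-second ψ ρ standard step v =
  ℤ-induction-from (λ w → Sat 𝕄 ((chain , w) ∷ₑ ρ) ψ)
    (transfer ψ ℕ.≤-refl (ℕ.n≤1+n _) far-apart (standard (b ℕ.+ suc K))) (λ _ → step) -B≤v
  where
  K N : ℕ
  K = rank ψ
  N = scope ψ
  W : ℕ → Point
  W = withOrigins N ρ
  b : ℕ
  b = radius W (suc (suc N)) ⊔ ∣ v ∣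
  B : ℤ
  B = + b + + suc K
  far-pair : ∀ q → ∣ pos q ∣ ℕ.≤ b → offset q (second , B) ≈[ K ] offset q (chain , - B)
  far-pair (first  , u) _     = same
  far-pair (second , u) bound = above (finite (far-above u bound)) infinite
  far-pair (chain  , u) bound = below infinite (finite (far-below u bound))
  far-apart : Similar K (suc (suc (suc N))) ((second , B) ∷ₑ W) ((chain , - B) ∷ₑ W)
  far-apart = Similar-∷ ℕ.≤-refl Similar-refl refl λ {i} i<2+N →
    far-pair (W i) (ℕ.m≤n⇒m≤n⊔o ∣ v ∣ (radius-bound W i<2+N))
  -B≤v : - B ≤ v
  -B≤v = ℤ.≤-trans (ℤ.neg-mono-≤ (ℤ.i≤i+j (+ b) (+ suc K)))
                   (∣i∣≤n⇒-n≤i (ℕ.m≤n⊔m (radius W (suc (suc N))) ∣ v ∣))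

successor-injective : ∀ p q → successor p ≡ successor q → p ≡ q
successor-injective (l , u) (l' , v) eq =
  cong₂ _,_ (cong line eq)
            (trans (sym (ℤ.pred-suc u)) (trans (cong ℤ.pred (cong pos eq)) (ℤ.pred-suc v)))

successor≡origin : ∀ p l → successor p ≡ (l , 0ℤ) → p ≡ (l , -[1+ 0 ])
successor≡origin (l' , v) l eq =
  cong₂ _,_ (cong line eq) (trans (sym (ℤ.pred-suc v)) (cong ℤ.pred (cong pos eq)))

IsN₁? : ∀ p → Dec (IsN₁ p)
IsN₁? (l , v) = (l ≟ₗ first) ×-dec (0ℤ ℤ.≤? v)

IsN₂? : ∀ p → Dec (IsN₂ p)
IsN₂? (l , v) = ((l ≟ₗ second) ×-dec (0ℤ ℤ.≤? v)) ⊎-dec (l ≟ₗ chain)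

IsN₁-successor : ∀ p → IsN₁ p → IsN₁ (successor p)
IsN₁-successor (l , v) (l≡first , 0≤v) = l≡first , ℤ.i≤j⇒i≤1+j 0≤v

IsN₂-successor : ∀ p → IsN₂ p → IsN₂ (successor p)
IsN₂-successor (l , v) (inj₁ (l≡second , 0≤v)) = inj₁ (l≡second , ℤ.i≤j⇒i≤1+j 0≤v)
IsN₂-successor (l , v) (inj₂ l≡chain)          = inj₂ l≡chain

N₁-Peano : PeanoModel 𝕄 IsN₁ origin₁ successor
N₁-Peano = record
  { zero-N    = λ ∉N → ∉N (refl , ℤ.≤-refl)
  ; suc-N     = λ x → ¬¬-map (IsN₁-successor x)
  ; suc≢0     = λ x x∈N s≡0 → x∈N (-1∉N ∘ subst IsN₁ (successor≡origin x first s≡0))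
  ; suc-inj   = λ x y _ _ → ¬¬-map (successor-injective x y)
  ; induction = induction
  }
  where
  -1∉N : ¬ IsN₁ (first , -[1+ 0 ])
  -1∉N (_ , ())
  induction : ∀ ψ ρ → Sat 𝕄 (origin₁ ∷ₑ ρ) ψ →
              (∀ x → ¬¬ IsN₁ x → Sat 𝕄 (x ∷ₑ ρ) ψ → Sat 𝕄 (successor x ∷ₑ ρ) ψ) →
              ∀ x → ¬¬ IsN₁ x → Sat 𝕄 (x ∷ₑ ρ) ψ
  induction ψ ρ base step x x∈N with decidable-stable (IsN₁? x) x∈N
  ... | refl , 0≤v = ℤ-induction-from (λ v → Sat 𝕄 ((first , v) ∷ₑ ρ) ψ) base
                       (λ {v} 0≤v → step (first , v) (λ ∉N → ∉N (refl , 0≤v))) 0≤v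

N₂-Peano : PeanoModel 𝕄 IsN₂ origin₂ successor
N₂-Peano = record
  { zero-N    = λ ∉N → ∉N (inj₁ (refl , ℤ.≤-refl))
  ; suc-N     = λ x → ¬¬-map (IsN₂-successor x)
  ; suc≢0     = λ x x∈N s≡0 → x∈N (-1∉N ∘ subst IsN₂ (successor≡origin x second s≡0))
  ; suc-inj   = λ x y _ _ → ¬¬-map (successor-injective x y)
  ; induction = induction
  }
  where
  -1∉N : ¬ IsN₂ (second , -[1+ 0 ])
  -1∉N (inj₁ (_ , ()))
  -1∉N (inj₂ ())
  induction : ∀ ψ ρ → Sat 𝕄 (origin₂ ∷ₑ ρ) ψ →
              (∀ x → ¬¬ IsN₂ x → Sat 𝕄 (x ∷ₑ ρ) ψ → Sat 𝕄 (successor x ∷ₑ ρ) ψ) →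
              ∀ x → ¬¬ IsN₂ x → Sat 𝕄 (x ∷ₑ ρ) ψ
  induction ψ ρ base step x x∈N = by-cases x (decidable-stable (IsN₂? x) x∈N)
    where
    standard : ∀ {v} → 0ℤ ≤ v → Sat 𝕄 ((second , v) ∷ₑ ρ) ψ
    standard = ℤ-induction-from (λ v → Sat 𝕄 ((second , v) ∷ₑ ρ) ψ) base
                 (λ {v} 0≤v → step (second , v) (λ ∉N → ∉N (inj₁ (refl , 0≤v))))
    by-cases : ∀ x → IsN₂ x → Sat 𝕄 (x ∷ₑ ρ) ψ
    by-cases (_ , v) (inj₁ (refl , 0≤v)) = standard 0≤v
    by-cases (_ , v) (inj₂ refl) =
      chain-from-second ψ ρ (λ _ → standard (+≤+ z≤n))
        (λ {w} → step (chain , w) (λ ∉N → ∉N (inj₂ refl))) v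

IsN₁⇒standard : ∀ p → IsN₁ p → ∃ λ k → p ≡ (first , + k)
IsN₁⇒standard (first , + k) (refl , _) = k , refl

¬Iso : ¬ Iso 𝕄
¬Iso iso = g-into y y∈N₂ λ gy∈N₁ → not-standard (IsN₁⇒standard (g y) gy∈N₁)
  where
  open Iso iso
  y : Point
  y = chain , 0ℤ
  y∈N₂ : ¬¬ IsN₂ y
  y∈N₂ ∉N = ∉N (inj₂ refl)
  f-standard : ∀ k → ¬¬ (f (first , + k) ≡ (second , + k))
  f-standard zero    = f-zero
  f-standard (suc k) f≢ = f-suc (first , + k) (λ ∉N → ∉N (refl , +≤+ z≤n)) λ f-suc≡ →
    f-standard k λ f≡ → f≢ (trans f-suc≡ (cong successor f≡))
  not-standard : ¬ ∃ (λ k → g y ≡ (first , + k))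
  not-standard (k , gy≡) = fg y y∈N₂ λ fgy≡y → f-standard k λ f≡ →
    second≢chain (cong line (trans (sym f≡) (trans (cong f (sym gy≡)) fgy≡y)))
    where
    second≢chain : second ≢ chain
    second≢chain ()

mainTheorem1 : Σ Structure (λ M → ModelOfT₁∪T₂ M × ¬ Iso M)
mainTheorem1 = 𝕄 , (N₁-Peano , N₂-Peano) , ¬Iso
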